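{- Let $p$ be an odd prime, $K$ a finite extension of $\mathbb{Q}_p$ with absolute ramification index $e$, and $L/K$ a degree $p$ extension whose normal closure $\widetilde L$ has Galois group over $K$ dihedral of order $2p$, with $\widetilde L/K$ totally ramified. Let $t$ be the ramification jump of $\widetilde L/K$, $\ell=\frac{p+t}{2}$, $a$ the remainder of $\ell$ modulo $p$, $a_0=\lfloor\ell/p\rfloor$, assume $a\ne0$, and set $\nu_i=\lfloor\frac{a+i\ell}{p}\rfloor$ for $0\le i\le p-1$. Then: (1) $\nu_{p-1}=a+(p-1)a_0$; (2) $\nu_{p-1}\le e+\frac{p-1}{2}$; (3) $\nu_{p-1}=e+\frac{p-1}{2}$ if and only if $t\ge\frac{2pe}{p-1}-2$; (4) for $0\le k\le p-3$, $\nu_{k+2}-\nu_k\ge1$, and if $a_0>0$ then $\nu_{k+2}-\nu_k\ge2$; (5) $\nu_{p-1}-\nu_{p-2}\ge1$ and $\nu_{p-2}-\nu_{p-3}\ge1$; (6) $\nu_s<e+\lceil s/2\rceil$ for all $0\le s\le p-2$.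
   Context: The ramification jump $t$ of $\widetilde L/K$ is the integer with $G_t$ of order $p$ and $G_{t+1}$ trivial (lower numbering); it satisfies $1\le t\le\frac{2pe}{p-1}$ and is odd, so $\ell$ is an integer; $a\neq0$ is equivalent to $t<\frac{2pe}{p-1}$. -}

module Defs where

open import Data.Nat using (ℕ; suc; _+_; _*_; _/_; _%_; NonZero)

-- ℓ = (p + t)/2  (p and t odd, so p + t is even and the division is exact)
ell : ℕ → ℕ → ℕ
ell p t = (p + t) / 2

aRem : (p t : ℕ) → .{{NonZero p}} → ℕ
aRem p t = ell p t % p

a₀ : (p t : ℕ) → .{{NonZero p}} → ℕ
a₀ p t = ell p t / p

ν : (p t : ℕ) → .{{NonZero p}} → ℕ → ℕ
ν p t i = (aRem p t + i * ell p t) / p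

ceilHalf : ℕ → ℕ
ceilHalf s = (s + 1) / 2

-- Write ℓ = a + a₀ p with 0 < a < p. Then p ν_{p-1} = a + (p-1)ℓ exactly, so ν_{p-1} = a + (p-1)a₀, and
-- 2ℓ = p + t turns the jump bound (p-1)t ≤ 2pe into the identity
--   2p ν_{p-1} + D = 2p (e + (p-1)/2) + 2a,   D = 2pe - (p-1)t,
-- a division by 2p with remainder 2a < 2p. Hence ν_{p-1} ≤ e + (p-1)/2, with equality iff D = 2a,
-- which happens iff D ≤ 2(p-1), i.e. iff 2pe ≤ (p-1)(t+2). Passing from ν_k to ν_{k+2} adds
-- 2ℓ = p + t ≥ p to the numerator, so ν grows by at least 1 every two steps (by 2 if ℓ ≥ p). The last
-- gap uses that p ν_{p-1} is exact, the one before it that 2a = p + t > p when a₀ = 0; the bound (6)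
-- then descends in steps of two from s = p-2 and s = p-3.
module Submission where

open import Defs
open import Data.Nat
  using (ℕ; zero; suc; _+_; _*_; _∸_; _≤_; _<_; _%_; _/_; NonZero; z≤n; s≤s; s≤s⁻¹;
         nonTrivial⇒≢1)
open import Data.Nat.Properties
open import Data.Nat.DivMod
open import Data.Nat.Divisibility using (m%n≡0⇒n∣m)
open import Data.Nat.Primality using (Prime; prime⇒nonTrivial; prime⇒irreducible)
open import Data.Nat.Tactic.RingSolver using (solve-∀)
open import Data.Product using (_×_; _,_; ∃-syntax)
open import Data.Sum using (inj₁; inj₂)
open import Function.Bundles using (_⇔_; mk⇔)
open import Function.Construct.Composition using (_⇔-∘_)
open import Relation.Nullary using (contradiction)
open import Relation.Binary.PropositionalEquality
  using (_≡_; _≢_; refl; sym; trans; cong; cong₂; subst; subst₂; module ≡-Reasoning)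

m*n≤o⇒m≤o/n : ∀ {m o} n .{{_ : NonZero n}} → m * n ≤ o → m ≤ o / n
m*n≤o⇒m≤o/n {m} {o} n h = subst (_≤ o / n) (m*n/n≡m m n) (/-monoˡ-≤ n h)

[m*n+o]/n≡m : ∀ m {n o} .{{_ : NonZero n}} → o < n → (m * n + o) / n ≡ m
[m*n+o]/n≡m m {n} {o} o<n = ≤-antisym
  (s≤s⁻¹ (m<n*o⇒m/o<n (subst (m * n + o <_) (+-comm (m * n) n) (+-monoʳ-< (m * n) o<n))))
  (m*n≤o⇒m≤o/n n (m≤m+n (m * n) o))

m/n+o/n≤[m+o]/n : ∀ m o n .{{_ : NonZero n}} → m / n + o / n ≤ (m + o) / n
m/n+o/n≤[m+o]/n m o n = m*n≤o⇒m≤o/n n (begin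
  (m / n + o / n) * n     ≡⟨ *-distribʳ-+ n (m / n) (o / n) ⟩
  m / n * n + o / n * n   ≤⟨ +-mono-≤ (m/n*n≤m m n) (m/n*n≤m o n) ⟩
  m + o                   ∎)
  where open ≤-Reasoning

odd⇒≡1+j*2 : ∀ {n} → n % 2 ≡ 1 → ∃[ j ] n ≡ 1 + j * 2
odd⇒≡1+j*2 {n} n-odd = n / 2 , trans (m≡m%n+[m/n]*n n 2) (cong (_+ n / 2 * 2) n-odd)

odd+odd-halves : ∀ {m n} → m % 2 ≡ 1 → n % 2 ≡ 1 → m + n ≡ 2 * ((m + n) / 2)
odd+odd-halves {m} {n} m-odd n-odd = sym (m*[n/m]≡n (m%n≡0⇒n∣m (m + n) 2 even))
  where
  even : (m + n) % 2 ≡ 0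
  even = trans (%-distribˡ-+ m n 2) (cong₂ (λ x y → (x + y) % 2) m-odd n-odd)

odd-prime⇒odd : ∀ {p} → Prime p → p ≢ 2 → p % 2 ≡ 1
odd-prime⇒odd {p} pr p≢2 with p % 2 in p%2 | m%n<n p 2
... | 1           | _ = refl
... | suc (suc _) | s≤s (s≤s ())
... | 0           | _ with prime⇒irreducible pr (m%n≡0⇒n∣m p 2 p%2)
...   | inj₁ ()
...   | inj₂ 2≡p = contradiction (sym 2≡p) p≢2

odd-prime⇒≡3+m*2 : ∀ {p} → Prime p → p ≢ 2 → ∃[ m ] p ≡ 3 + m * 2
odd-prime⇒≡3+m*2 pr p≢2 with odd⇒≡1+j*2 (odd-prime⇒odd pr p≢2)
... | zero  , p≡1 = contradiction p≡1 (nonTrivial⇒≢1 {{prime⇒nonTrivial pr}})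
... | suc m , p≡  = m , p≡

ceilHalf-2+ : ∀ s → ceilHalf (2 + s) ≡ suc (ceilHalf s)
ceilHalf-2+ s = m/n≡1+[m∸n]/n {2 + (s + 1)} {2} (s≤s (s≤s z≤n))

ceilHalf-even : ∀ j → ceilHalf (j * 2) ≡ j
ceilHalf-even zero    = refl
ceilHalf-even (suc j) = trans (ceilHalf-2+ (j * 2)) (cong suc (ceilHalf-even j))

ceilHalf-odd : ∀ j → ceilHalf (1 + j * 2) ≡ suc j
ceilHalf-odd zero    = refl
ceilHalf-odd (suc j) = trans (ceilHalf-2+ (1 + j * 2)) (cong suc (ceilHalf-odd j))

descend-by-2 : ∀ {n} (Q : ℕ → Set) → (∀ k → Q (2 + k) → Q k) → Q n → Q (suc n) →
               ∀ s → s ≤ suc n → Q s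
descend-by-2 {n} Q step Qn Q1+n s s≤1+n = go (suc n ∸ s) s (m+[n∸m]≡n s≤1+n)
  where
  go : ∀ d s → s + d ≡ suc n → Q s
  go zero          s eq = subst Q (sym (trans (sym (+-identityʳ s)) eq)) Q1+n
  go (suc zero)    s eq = subst Q (sym (suc-injective (trans (+-comm 1 s) eq))) Qn
  go (suc (suc d)) s eq = step s (go d (2 + s) (trans (sym s+2+d) eq))
    where
    s+2+d : s + suc (suc d) ≡ 2 + s + d
    s+2+d = trans (+-suc s (suc d)) (cong suc (+-suc s d))

-- ν_{p-3} < ν_{p-2} in the case a₀ = 0, where ℓ = a and 2a = p + t > p (here p = 3 + k).
[a+k*a]/[3+k]<[a+[1+k]*a]/[3+k] : ∀ k a → 3 + k < 2 * a → a < 3 + k →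
  (a + k * a) / (3 + k) < (a + suc k * a) / (3 + k)
[a+k*a]/[3+k]<[a+[1+k]*a]/[3+k] k zero    ()
[a+k*a]/[3+k]<[a+[1+k]*a]/[3+k] k (suc b) 3+k<2a a<3+k =
  ≤-trans (m<n*o⇒m/o<n {n = b} {o = 3 + k} below) (m*n≤o⇒m≤o/n (3 + k) above)
  where
  open ≤-Reasoning
  1+k<2b : 1 + k < 2 * b
  1+k<2b = +-cancelˡ-< 2 (1 + k) (2 * b) (subst (3 + k <_) (*-suc 2 b) 3+k<2a)
  split : ∀ b k → b * (3 + k) ≡ 2 * b + (b + k * b)
  split = solve-∀
  below : suc b + k * suc b < b * (3 + k)
  below = begin-strict
    suc b + k * suc b        ≡⟨ lhs b k ⟩
    (1 + k) + (b + k * b)    <⟨ +-monoˡ-< (b + k * b) 1+k<2b ⟩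
    2 * b + (b + k * b)      ≡⟨ sym (split b k) ⟩
    b * (3 + k)              ∎
    where
    lhs : ∀ b k → suc b + k * suc b ≡ (1 + k) + (b + k * b)
    lhs = solve-∀
  above : b * (3 + k) ≤ suc b + suc k * suc b
  above = begin
    b * (3 + k)              ≡⟨ split b k ⟩
    2 * b + (b + k * b)      ≤⟨ +-monoʳ-≤ (2 * b) (+-monoˡ-≤ (k * b) (<⇒≤ (s≤s⁻¹ a<3+k))) ⟩
    2 * b + (2 + k + k * b)  ≡⟨ rhs b k ⟩
    suc b + suc k * suc b    ∎
    where
    rhs : ∀ b k → 2 * b + (2 + k + k * b) ≡ suc b + suc k * suc b
    rhs = solve-∀

-- p = 3 + 2m is written 3 + m * 2 so that p ∸ 1, p ∸ 2 and p ∸ 3 reduce to 2 + m * 2, 1 + m * 2, m * 2.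
module FloorSequence
  (m e t ℓ a q : ℕ)
  (ℓ≡a+q*p : ℓ ≡ a + q * (3 + m * 2)) (1≤a : 1 ≤ a) (a<p : a < 3 + m * 2)
  (p+t≡2ℓ : 3 + m * 2 + t ≡ 2 * ℓ) (1≤t : 1 ≤ t)
  (jump-bound : (2 + m * 2) * t ≤ 2 * (3 + m * 2) * e)
  where

  p n′ V D : ℕ
  p = 3 + m * 2
  n′ = 2 + m * 2
  V = a + n′ * q
  D = 2 * p * e ∸ n′ * t

  ν′ : ℕ → ℕ
  ν′ i = (a + i * ℓ) / p

  n′t+D≡2pe : n′ * t + D ≡ 2 * p * e
  n′t+D≡2pe = m+[n∸m]≡n jump-bound

  p≤2ℓ : p ≤ 2 * ℓ
  p≤2ℓ = subst (p ≤_) p+t≡2ℓ (m≤m+n p t)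

  1≤ℓ : 1 ≤ ℓ
  1≤ℓ = ≤-trans 1≤a (subst (a ≤_) (sym ℓ≡a+q*p) (m≤m+n a (q * p)))

  a+n′ℓ≡Vp : a + n′ * ℓ ≡ V * p
  a+n′ℓ≡Vp = trans (cong (λ x → a + n′ * x) ℓ≡a+q*p) (expand m a q)
    where
    expand : ∀ m a q → a + (2 + m * 2) * (a + q * (3 + m * 2)) ≡ (a + (2 + m * 2) * q) * (3 + m * 2)
    expand = solve-∀

  ν-last : ν′ n′ ≡ V
  ν-last = trans (cong (_/ p) a+n′ℓ≡Vp) (m*n/n≡m V p)

  ν-gap : ∀ {c d} k → c * p ≤ d * ℓ → c + ν′ k ≤ ν′ (k + d)
  ν-gap {c} {d} k h = begin
    c + ν′ k                       ≤⟨ +-monoˡ-≤ (ν′ k) (m*n≤o⇒m≤o/n p h) ⟩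
    d * ℓ / p + ν′ k               ≡⟨ +-comm (d * ℓ / p) (ν′ k) ⟩
    ν′ k + d * ℓ / p               ≤⟨ m/n+o/n≤[m+o]/n (a + k * ℓ) (d * ℓ) p ⟩
    (a + k * ℓ + d * ℓ) / p       ≡⟨ cong (_/ p) regroup ⟩
    ν′ (k + d)                     ∎
    where
    open ≤-Reasoning
    regroup : a + k * ℓ + d * ℓ ≡ a + (k + d) * ℓ
    regroup = trans (+-assoc a (k * ℓ) (d * ℓ)) (cong (a +_) (sym (*-distribʳ-+ ℓ k d)))

  ν-step : ∀ k → 1 + ν′ k ≤ ν′ (k + 2)
  ν-step k = ν-gap k (subst (_≤ 2 * ℓ) (sym (*-identityˡ p)) p≤2ℓ)

  p≤ℓ : 1 ≤ q → p ≤ ℓ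
  p≤ℓ 1≤q = begin
    p          ≡⟨ sym (*-identityˡ p) ⟩
    1 * p      ≤⟨ *-monoˡ-≤ p 1≤q ⟩
    q * p      ≤⟨ m≤n+m (q * p) a ⟩
    a + q * p  ≡⟨ sym ℓ≡a+q*p ⟩
    ℓ          ∎
    where open ≤-Reasoning

  ν-step-a₀ : 1 ≤ q → ∀ k → 2 + ν′ k ≤ ν′ (k + 2)
  ν-step-a₀ 1≤q k = ν-gap k (*-monoʳ-≤ 2 (p≤ℓ 1≤q))

  ν-penultimate : 1 + ν′ (1 + m * 2) ≤ ν′ n′
  ν-penultimate = subst (ν′ (1 + m * 2) <_) (sym ν-last) (m<n*o⇒m/o<n (begin-strict
    a + (1 + m * 2) * ℓ       <⟨ +-monoʳ-< a (m<n+m ((1 + m * 2) * ℓ) 1≤ℓ) ⟩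
    a + n′ * ℓ                ≡⟨ a+n′ℓ≡Vp ⟩
    V * p                     ∎))
    where open ≤-Reasoning

  ν-antepenultimate : 1 + ν′ (m * 2) ≤ ν′ (1 + m * 2)
  ν-antepenultimate with m≤n⇒m<n∨m≡n (z≤n {q})
  ... | inj₁ 1≤q = subst (λ i → 1 + ν′ (m * 2) ≤ ν′ i) (+-comm (m * 2) 1)
                     (ν-gap (m * 2) (*-monoʳ-≤ 1 (p≤ℓ 1≤q)))
  ... | inj₂ 0≡q = subst (λ x → (a + m * 2 * x) / p < (a + (1 + m * 2) * x) / p) (sym ℓ≡a)
                     ([a+k*a]/[3+k]<[a+[1+k]*a]/[3+k] (m * 2) a p<2a a<p)
    where
    ℓ≡a : ℓ ≡ a
    ℓ≡a = trans ℓ≡a+q*p (trans (cong (λ x → a + x * p) (sym 0≡q)) (+-identityʳ a))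
    p<2a : p < 2 * a
    p<2a = subst (p <_) (trans p+t≡2ℓ (cong (2 *_) ℓ≡a)) (m<m+n p 1≤t)

  division-identity : V * (2 * p) + D ≡ (e + suc m) * (2 * p) + 2 * a
  division-identity = begin
    V * (2 * p) + D                          ≡⟨ cong (_+ D) (x*[2*y]≡2*[x*y] V p) ⟩
    2 * (V * p) + D                          ≡⟨ cong (λ x → 2 * x + D) (sym a+n′ℓ≡Vp) ⟩
    2 * (a + n′ * ℓ) + D                     ≡⟨ cong (_+ D) (*-distribˡ-+ 2 a (n′ * ℓ)) ⟩
    2 * a + 2 * (n′ * ℓ) + D                 ≡⟨ cong (λ x → 2 * a + x + D) (sym (x*[2*y]≡2*[x*y] n′ ℓ)) ⟩
    2 * a + n′ * (2 * ℓ) + D                 ≡⟨ cong (λ x → 2 * a + n′ * x + D) (sym p+t≡2ℓ) ⟩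
    2 * a + n′ * (p + t) + D                 ≡⟨ cong (λ x → 2 * a + x + D) (*-distribˡ-+ n′ p t) ⟩
    2 * a + (n′ * p + n′ * t) + D            ≡⟨ regroup (2 * a) (n′ * p) (n′ * t) D ⟩
    2 * a + (n′ * p + (n′ * t + D))          ≡⟨ cong (λ x → 2 * a + (n′ * p + x)) n′t+D≡2pe ⟩
    2 * a + (n′ * p + 2 * p * e)             ≡⟨ cong (2 * a +_) (n′p+2pe m e p) ⟩
    2 * a + (e + suc m) * (2 * p)            ≡⟨ +-comm (2 * a) _ ⟩
    (e + suc m) * (2 * p) + 2 * a            ∎
    where
    open ≡-Reasoning
    x*[2*y]≡2*[x*y] : ∀ x y → x * (2 * y) ≡ 2 * (x * y)
    x*[2*y]≡2*[x*y] = solve-∀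
    regroup : ∀ w x y z → w + (x + y) + z ≡ w + (x + (y + z))
    regroup = solve-∀
    n′p+2pe : ∀ m e p → (2 + m * 2) * p + 2 * p * e ≡ (e + suc m) * (2 * p)
    n′p+2pe = solve-∀

  2a<2p : 2 * a < 2 * p
  2a<2p = *-monoʳ-< 2 a<p

  [V*2p+D]/2p≡e+suc-m : (V * (2 * p) + D) / (2 * p) ≡ e + suc m
  [V*2p+D]/2p≡e+suc-m = trans (cong (_/ (2 * p)) division-identity) ([m*n+o]/n≡m (e + suc m) 2a<2p)

  V≤e+suc-m : V ≤ e + suc m
  V≤e+suc-m = ≤-trans (m*n≤o⇒m≤o/n (2 * p) (m≤m+n (V * (2 * p)) D))
                      (≤-reflexive [V*2p+D]/2p≡e+suc-m)

  2[e+suc-m]≡2e+n′ : 2 * (e + suc m) ≡ 2 * e + n′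
  2[e+suc-m]≡2e+n′ = trans (*-distribˡ-+ 2 e (suc m)) (cong (2 * e +_) (*-comm 2 (suc m)))

  2ν-last≤2e+n′ : 2 * ν′ n′ ≤ 2 * e + n′
  2ν-last≤2e+n′ = subst₂ _≤_ (cong (2 *_) (sym ν-last)) 2[e+suc-m]≡2e+n′ (*-monoʳ-≤ 2 V≤e+suc-m)

  2ν-last≡⇔V≡ : (2 * ν′ n′ ≡ 2 * e + n′) ⇔ (V ≡ e + suc m)
  2ν-last≡⇔V≡ = mk⇔
    (λ h → *-cancelˡ-≡ V (e + suc m) 2
             (trans (cong (2 *_) (sym ν-last)) (trans h (sym 2[e+suc-m]≡2e+n′))))
    (λ h → trans (cong (2 *_) (trans ν-last h)) 2[e+suc-m]≡2e+n′)

  V≡⇔D≤n′*2 : (V ≡ e + suc m) ⇔ (D ≤ n′ * 2)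
  V≡⇔D≤n′*2 = mk⇔ to from
    where
    to : V ≡ e + suc m → D ≤ n′ * 2
    to V≡ = subst (_≤ n′ * 2) (sym D≡2a) (subst (_≤ n′ * 2) (*-comm a 2) (*-monoˡ-≤ 2 (s≤s⁻¹ a<p)))
      where
      D≡2a : D ≡ 2 * a
      D≡2a = +-cancelˡ-≡ (V * (2 * p)) D (2 * a)
               (trans division-identity (cong (λ x → x * (2 * p) + 2 * a) (sym V≡)))
    from : D ≤ n′ * 2 → V ≡ e + suc m
    from D≤ = trans (sym ([m*n+o]/n≡m V D<2p)) [V*2p+D]/2p≡e+suc-m
      where
      D<2p : D < 2 * p
      D<2p = ≤-<-trans D≤ (subst (n′ * 2 <_) (*-comm p 2) (*-monoˡ-< 2 (n<1+n n′)))

  D≤n′*2⇔ : (D ≤ n′ * 2) ⇔ (2 * p * e ≤ n′ * (t + 2))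
  D≤n′*2⇔ = mk⇔
    (λ h → subst₂ _≤_ n′t+D≡2pe (sym (*-distribˡ-+ n′ t 2)) (+-monoʳ-≤ (n′ * t) h))
    (λ h → +-cancelˡ-≤ (n′ * t) D (n′ * 2)
             (subst₂ _≤_ (sym n′t+D≡2pe) (*-distribˡ-+ n′ t 2) h))

  2ν-last≡⇔ : (2 * ν′ n′ ≡ 2 * e + n′) ⇔ (2 * p * e ≤ n′ * (t + 2))
  2ν-last≡⇔ = D≤n′*2⇔ ⇔-∘ (V≡⇔D≤n′*2 ⇔-∘ 2ν-last≡⇔V≡)

  ν<e+ceilHalf : ∀ s → s ≤ 1 + m * 2 → ν′ s < e + ceilHalf s
  ν<e+ceilHalf = descend-by-2 (λ s → ν′ s < e + ceilHalf s) step top-even top-odd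
    where
    ν-top-odd≤ : suc (ν′ (1 + m * 2)) ≤ e + suc m
    ν-top-odd≤ = ≤-trans ν-penultimate (subst (_≤ e + suc m) (sym ν-last) V≤e+suc-m)
    top-odd : ν′ (1 + m * 2) < e + ceilHalf (1 + m * 2)
    top-odd = subst (λ c → ν′ (1 + m * 2) < e + c) (sym (ceilHalf-odd m)) ν-top-odd≤
    top-even : ν′ (m * 2) < e + ceilHalf (m * 2)
    top-even = subst (λ c → ν′ (m * 2) < e + c) (sym (ceilHalf-even m))
                 (s≤s⁻¹ (≤-trans (s≤s ν-antepenultimate) ν-top-odd≤′))
      where
      ν-top-odd≤′ : suc (ν′ (1 + m * 2)) ≤ suc (e + m)
      ν-top-odd≤′ = subst (suc (ν′ (1 + m * 2)) ≤_) (+-suc e m) ν-top-odd≤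
    step : ∀ k → ν′ (2 + k) < e + ceilHalf (2 + k) → ν′ k < e + ceilHalf k
    step k h = s≤s⁻¹ (begin
      suc (suc (ν′ k))          ≤⟨ s≤s (subst (λ i → 1 + ν′ k ≤ ν′ i) (+-comm k 2) (ν-step k)) ⟩
      suc (ν′ (2 + k))          ≤⟨ h ⟩
      e + ceilHalf (2 + k)      ≡⟨ cong (e +_) (ceilHalf-2+ k) ⟩
      e + suc (ceilHalf k)      ≡⟨ +-suc e (ceilHalf k) ⟩
      suc (e + ceilHalf k)      ∎)
      where open ≤-Reasoning

proposition6p2 : (p e t : ℕ) → .{{_ : NonZero p}} →
    Prime p → p ≢ 2 →
    1 ≤ e →
    t % 2 ≡ 1 → 1 ≤ t → (p ∸ 1) * t ≤ 2 * p * e →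
    aRem p t ≢ 0 →
    (ν p t (p ∸ 1) ≡ aRem p t + (p ∸ 1) * a₀ p t)
    × (2 * ν p t (p ∸ 1) ≤ 2 * e + (p ∸ 1))
    × ((2 * ν p t (p ∸ 1) ≡ 2 * e + (p ∸ 1)) ⇔ (2 * p * e ≤ (p ∸ 1) * (t + 2)))
    × (∀ k → k ≤ p ∸ 3 → 1 + ν p t k ≤ ν p t (k + 2))
    × (∀ k → k ≤ p ∸ 3 → 1 ≤ a₀ p t → 2 + ν p t k ≤ ν p t (k + 2))
    × (1 + ν p t (p ∸ 2) ≤ ν p t (p ∸ 1))
    × (1 + ν p t (p ∸ 3) ≤ ν p t (p ∸ 2))
    × (∀ s → s ≤ p ∸ 2 → ν p t s < e + ceilHalf s)
proposition6p2 p e t pr p≢2 _ t-odd 1≤t jump-bound a≢0 with odd-prime⇒≡3+m*2 pr p≢2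
... | m , refl =
  ν-last , 2ν-last≤2e+n′ , 2ν-last≡⇔ , (λ k _ → ν-step k) , (λ k _ 1≤a₀ → ν-step-a₀ 1≤a₀ k) ,
  ν-penultimate , ν-antepenultimate , ν<e+ceilHalf
  where
  open FloorSequence m e t (ell p t) (aRem p t) (a₀ p t)
    (m≡m%n+[m/n]*n (ell p t) p) (n≢0⇒n>0 a≢0) (m%n<n (ell p t) p)
    (odd+odd-halves {p} ([m+kn]%n≡m%n 3 m 2) t-odd) 1≤t jump-bound
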